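{- Let a GCR game family be given (as in the context) and let $T^0,T^1,T^2,\dots$ be the labels produced by the vertex labeling algorithm, with $\overline{T}(s)=\lim_{i\to\infty}T^i(s)$ and $\widetilde{T}(s)=\min\{i: T^i(s)<\infty\}$ (with $\min\emptyset=\infty$). Then for all $s\in\overline{S}$ and all $n\in\mathbb{N}_0$: if $\widetilde{T}(s)=n$, then for all $i\ge n$ we have $T^i(s)=\overline{T}(s)\le n$.
   Context: A GCR game family consists of: finite location sets $V^1,V^2$; the set of nonterminal states $\overline{S}=V^1\times V^2\times\{1,2\}$, where in state $(x^1,x^2,n)$ player $P^n$ has the move ($P^1$ is the Pursuer, $P^2$ the Evader); $S^n=\{(x^1,x^2,n): x^1\in V^1,x^2\in V^2\}$ for $n\in\{1,2\}$; a set of capture states $S_c\subseteq\overline{S}$, with $S_{nc}=\overline{S}\setminus S_c$; for each $s\in S_{nc}$ a nonempty set $N(s)\subseteq\overline{S}$ of possible next states (for $s\in S_c$ the only successor is a terminal state $\tau$). Players need not alternate. Vertex labeling algorithm: for $s\in\overline{S}$ set $T^0(s)=0$ if $s\in S_c$ and $T^0(s)=\infty$ otherwise. For $i=1,2,\dots$ and each $s\in\overline{S}$: if $T^{i-1}(s)<\infty$ set $T^i(s)=T^{i-1}(s)$; otherwise, if $s\in S^1$ set $T^i(s)=1+\min_{s'\in N(s)}T^{i-1}(s')$, and if $s\in S^2$ set $T^i(s)=1+\max_{s'\in N(s)}T^{i-1}(s')$ (with $1+\infty=\infty$). For each $s$ the sequence $(T^i(s))_i$ is eventually constant, so $\overline{T}(s)=\lim_i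 T^i(s)\in\mathbb{N}_0\cup\{\infty\}$ is well defined. -}

module Defs where

open import Data.Nat using (ℕ; zero; suc; _≤_; _⊔_; _⊓_)
open import Data.Fin using (Fin)
open import Data.List using (List; []; _∷_; foldr; cartesianProduct; map; allFin)
open import Data.Bool using (Bool; true; false; if_then_else_)
open import Data.Product using (_×_; _,_; Σ; ∃)
open import Relation.Binary.PropositionalEquality using (_≡_)

-- Players: P1 = Pursuer, P2 = Evader
data Player : Set where
  P1 P2 : Player

allPlayers : List Player
allPlayers = P1 ∷ P2 ∷ []

data ℕ∞ : Set where
  fin : ℕ → ℕ∞
  ∞   : ℕ∞

suc∞ : ℕ∞ → ℕ∞
suc∞ (fin n) = fin (suc n)
suc∞ ∞       = ∞

min∞ : ℕ∞ → ℕ∞ → ℕ∞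
min∞ (fin m) (fin n) = fin (m ⊓ n)
min∞ (fin m) ∞       = fin m
min∞ ∞       y       = y

max∞ : ℕ∞ → ℕ∞ → ℕ∞
max∞ (fin m) (fin n) = fin (m ⊔ n)
max∞ (fin m) ∞       = ∞
max∞ ∞       y       = ∞

data _≤∞_ : ℕ∞ → ℕ∞ → Set where
  fin≤fin : ∀ {m n} → m ≤ n → fin m ≤∞ fin n
  _≤∞∞    : ∀ x → x ≤∞ ∞

-- Nonterminal states  V¹ × V² × {1,2}, with V¹ = Fin k₁, V² = Fin k₂
State : ℕ → ℕ → Set
State k₁ k₂ = Fin k₁ × Fin k₂ × Player

allStates : (k₁ k₂ : ℕ) → List (State k₁ k₂)
allStates k₁ k₂ =
  map (λ { (x , (y , p)) → (x , y , p) })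
      (cartesianProduct (allFin k₁) (cartesianProduct (allFin k₂) allPlayers))

-- A GCR game family: capture set S_c (as a decidable subset) and, for every
-- non-capture state, a nonempty set N(s) of possible next states.
record GCR (k₁ k₂ : ℕ) : Set where
  field
    capture  : State k₁ k₂ → Bool
    next     : State k₁ k₂ → State k₁ k₂ → Bool
    nonempty : ∀ s → capture s ≡ false → ∃ λ s' → next s s' ≡ true

mover : ∀ {k₁ k₂} → State k₁ k₂ → Player
mover (_ , _ , p) = p

module _ {k₁ k₂ : ℕ} (G : GCR k₁ k₂) where
  open GCR G

  -- min / max of f over N(s); the default value is only used when N(s) = ∅,
  -- which by `nonempty` never happens for states where these are evaluated.
  minN : State k₁ k₂ → (State k₁ k₂ → ℕ∞) → ℕ∞
  minN s f = foldr (λ s' acc → if next s s' then min∞ (f s') acc else acc) ∞ (allStates k₁ k₂)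

  maxN : State k₁ k₂ → (State k₁ k₂ → ℕ∞) → ℕ∞
  maxN s f = foldr (λ s' acc → if next s s' then max∞ (f s') acc else acc) (fin 0) (allStates k₁ k₂)

  step : (State k₁ k₂ → ℕ∞) → State k₁ k₂ → ℕ∞
  step T s with T s
  ... | fin m = fin m
  ... | ∞ with mover s
  ...   | P1 = suc∞ (minN s T)
  ...   | P2 = suc∞ (maxN s T)

  T : ℕ → State k₁ k₂ → ℕ∞
  T zero s    = if capture s then fin 0 else ∞
  T (suc i) s = step (T i) s

  -- T̃(s) = n, i.e. n = min{ i : T^i(s) < ∞ }
  TildeT≡ : State k₁ k₂ → ℕ → Set
  TildeT≡ s n = (Σ ℕ λ m → T n s ≡ fin m) × (∀ i → suc i ≤ n → T i s ≡ ∞)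

  -- v is the limit of the sequence (T^i(s))_i (eventually constant sequence)
  IsLimit : State k₁ k₂ → ℕ∞ → Set
  IsLimit s v = Σ ℕ λ N → ∀ i → N ≤ i → T i s ≡ v

module Submission where

-- Two facts about the labels T^i produced by the vertex
-- labeling algorithm give the proposition at once:
--   * freezing: once T^n(s) = m is finite, the update rule copies it, so
--     T^i(s) = m for every i ≥ n (hence m is the limit T̄(s));
--   * growth bound: every finite value of T^i is at most i.  At i = 0 the
--     only finite value is 0; a step either copies a value ≤ i or adds 1
--     to a min/max over N(s) of values of T^i, and min/max preserve the
--     bound "every finite value is ≤ i".  If T̃(s) = n with T^n(s) = m, freezing makes m the
-- limit, and the growth bound at n gives m ≤ n.

open import Defs
open import Data.Nat using (ℕ; _≤_; _≤′_; ≤′-refl; ≤′-step; zero; suc; z≤n; s≤s)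
open import Data.Nat.Properties using (⊔-lub; m≤n⇒m⊓o≤n; m≤n⇒m≤1+n; ≤⇒≤′)
open import Data.Product using (Σ; _×_; _,_)
open import Data.List using ([]; _∷_; foldr)
open import Data.Bool using (Bool; true; false; if_then_else_)
open import Relation.Binary.PropositionalEquality using (_≡_; refl)

FiniteAtMost : ℕ → ℕ∞ → Set
FiniteAtMost b v = ∀ m → v ≡ fin m → m ≤ b

min∞-atMost : ∀ b x y → FiniteAtMost b x → FiniteAtMost b y → FiniteAtMost b (min∞ x y)
min∞-atMost b (fin m) (fin n) hx hy .(_) refl = m≤n⇒m⊓o≤n n (hx m refl)
min∞-atMost b (fin m) ∞       hx hy k e = hx k e
min∞-atMost b ∞       y       hx hy k e = hy k e

max∞-atMost : ∀ b x y → FiniteAtMost b x → FiniteAtMost b y → FiniteAtMost b (max∞ x y)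
max∞-atMost b (fin m) (fin n) hx hy .(_) refl = ⊔-lub (hx m refl) (hy n refl)
max∞-atMost b (fin m) ∞       hx hy k ()
max∞-atMost b ∞       y       hx hy k ()

suc∞-atMost : ∀ b v → FiniteAtMost b v → FiniteAtMost (suc b) (suc∞ v)
suc∞-atMost b (fin x) h .(suc x) refl = s≤s (h x refl)
suc∞-atMost b ∞       h m ()

filteredFold-atMost :
  ∀ {A : Set} (select : A → Bool) (op : ℕ∞ → ℕ∞ → ℕ∞) (f : A → ℕ∞) (b : ℕ) (d : ℕ∞) →
  (∀ x y → FiniteAtMost b x → FiniteAtMost b y → FiniteAtMost b (op x y)) →
  (∀ a → FiniteAtMost b (f a)) → FiniteAtMost b d →
  ∀ xs → FiniteAtMost b (foldr (λ a acc → if select a then op (f a) acc else acc) d xs)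
filteredFold-atMost select op f b d op-ok f-ok d-ok [] = d-ok
filteredFold-atMost select op f b d op-ok f-ok d-ok (a ∷ xs) with select a
... | true  = op-ok (f a) _ (f-ok a) rest
  where rest = filteredFold-atMost select op f b d op-ok f-ok d-ok xs
... | false = filteredFold-atMost select op f b d op-ok f-ok d-ok xs

module _ {k₁ k₂ : ℕ} (G : GCR k₁ k₂) where
  open GCR G

  T0-atMost : ∀ s → FiniteAtMost 0 (T G 0 s)
  T0-atMost s m e with capture s
  T0-atMost s .0 refl | true = z≤n
  T0-atMost s m ()    | false

  T-atMost : ∀ i s → FiniteAtMost i (T G i s)
  T-atMost zero    s = T0-atMost s
  T-atMost (suc i) s m e with T G i s in eq
  T-atMost (suc i) s m refl | fin k = m≤n⇒m≤1+n (T-atMost i s k eq)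
  ... | ∞ with mover s
  ...   | P1 = suc∞-atMost i _ minBound m e
    where
    minBound : FiniteAtMost i (minN G s (T G i))
    minBound = filteredFold-atMost (next s) min∞ (T G i) i ∞
                 (min∞-atMost i) (T-atMost i) (λ _ ()) (allStates k₁ k₂)
  ...   | P2 = suc∞-atMost i _ maxBound m e
    where
    maxBound : FiniteAtMost i (maxN G s (T G i))
    maxBound = filteredFold-atMost (next s) max∞ (T G i) i (fin 0)
                 (max∞-atMost i) (T-atMost i) (λ { _ refl → z≤n }) (allStates k₁ k₂)

  T-frozen-step : ∀ i s m → T G i s ≡ fin m → T G (suc i) s ≡ fin m
  T-frozen-step i s m e with T G i s
  T-frozen-step i s m refl | fin .m = refl

  T-frozen : ∀ n s m → T G n s ≡ fin m → ∀ i → n ≤′ i → T G i s ≡ fin m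
  T-frozen n s m e .n       ≤′-refl        = e
  T-frozen n s m e (suc i) (≤′-step n≤′i) = T-frozen-step i s m (T-frozen n s m e i n≤′i)

proposition3p2 : ∀ {k₁ k₂ : ℕ} (G : GCR k₁ k₂) (s : State k₁ k₂) (n : ℕ) →
    TildeT≡ G s n →
    Σ ℕ∞ λ Tbar → IsLimit G s Tbar × ((∀ i → n ≤ i → T G i s ≡ Tbar) × Tbar ≤∞ fin n)
proposition3p2 G s n ((m , Tn≡m) , _) =
  fin m , (n , constantFrom-n) , constantFrom-n , fin≤fin (T-atMost G n s m Tn≡m)
  where
  constantFrom-n : ∀ i → n ≤ i → T G i s ≡ fin m
  constantFrom-n i n≤i = T-frozen G n s m Tn≡m i (≤⇒≤′ n≤i)
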